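{- Let $(X,\Sigma)$ be an implicational base with closure operator $\phi$, let $\mathcal{B}^+$ be an antichain of $\mathcal{L}(\Sigma)$, and let $\mathcal{H}=\{X\setminus B\mid B\in\mathcal{B}^+\}$. If $T$ is a transversal of $\mathcal{H}$, then every minimal generating set $T^*$ of $T$ is a transversal of $\mathcal{H}$. In particular, every minimal transversal of $\mathcal{H}$ is independent with respect to $\phi$.
   Context: An implicational base $(X,\Sigma)$ is a finite set $X$ with a finite set $\Sigma$ of implications $A\rightarrow b$, $A\subseteq X$, $b\in X$. A set $C\subseteq X$ is closed if for every $A\rightarrow b\in\Sigma$, $b\in C$ or $A\not\subseteq C$; $\phi(C)$ is the smallest closed set containing $C$. $\mathcal{L}(\Sigma)$ is the lattice of closed sets ordered by inclusion; an antichain is a family of pairwise inclusion-incomparable closed sets. A set $T\subseteq X$ is independent w.r.t. $\phi$ if $x\notin\phi(T\setminus\{x\})$ for all $x\in T$. For $I\subseteq X$, a set $T$ is a generating set of $I$ if $T\subseteq I\subseteq\phi(T)$, and it is a minimal generating set if moreover $I\not\subseteq\phi(T\setminus\{x\})$ for every $x\in T$. A transversal of $\mathcal{H}$ is a set meeting every hyperedge; minimal means inclusion-minimal. -}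

module Defs where

open import Data.Nat using (ℕ)
open import Data.Fin using (Fin)
open import Data.Fin.Subset using (Subset; _∈_; _∉_; _⊆_; _∩_; _-_; ∁; Nonempty)
open import Data.Product using (_×_; _,_)
open import Data.Sum using (_⊎_)
open import Data.List using (List; map)
import Data.List.Membership.Propositional as LM
open import Relation.Nullary using (¬_)
open import Relation.Binary.PropositionalEquality using (_≡_)

Implication : ℕ → Set
Implication n = Subset n × Fin n

Base : ℕ → Set
Base n = List (Implication n)

Closed : ∀ {n} → Base n → Subset n → Set
Closed Σ C = ∀ {A b} → (A , b) LM.∈ Σ → b ∈ C ⊎ ¬ (A ⊆ C)

-- x ∈ φ(C): x lies in every closed set containing C
-- (φ(C) is the smallest closed set containing C, i.e. the intersection
--  of all closed supersets of C).
_∈φ_ : ∀ {n} → Fin n → (Base n × Subset n) → Set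
x ∈φ (Σ , C) = ∀ D → Closed Σ D → C ⊆ D → x ∈ D

_⊆φ_ : ∀ {n} → Subset n → (Base n × Subset n) → Set
I ⊆φ ΣC = ∀ {x} → x ∈ I → x ∈φ ΣC

IsAntichain : ∀ {n} → Base n → List (Subset n) → Set
IsAntichain Σ 𝓑 =
  (∀ {B} → B LM.∈ 𝓑 → Closed Σ B) ×
  (∀ {B B′} → B LM.∈ 𝓑 → B′ LM.∈ 𝓑 → B ⊆ B′ → B ≡ B′)

complements : ∀ {n} → List (Subset n) → List (Subset n)
complements 𝓑 = map ∁ 𝓑

IsTransversal : ∀ {n} → List (Subset n) → Subset n → Set
IsTransversal H T = ∀ {E} → E LM.∈ H → Nonempty (T ∩ E)

IsMinimalTransversal : ∀ {n} → List (Subset n) → Subset n → Set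
IsMinimalTransversal H T =
  IsTransversal H T × (∀ T′ → T′ ⊆ T → IsTransversal H T′ → T ⊆ T′)

IsIndependent : ∀ {n} → Base n → Subset n → Set
IsIndependent Σ T = ∀ {x} → x ∈ T → ¬ (x ∈φ (Σ , (T - x)))

IsMinimalGeneratingSet : ∀ {n} → Base n → Subset n → Subset n → Set
IsMinimalGeneratingSet Σ T I =
  T ⊆ I × I ⊆φ (Σ , T) × (∀ {x} → x ∈ T → ¬ (I ⊆φ (Σ , (T - x))))

-- A closed set B that contains a generating set S of I contains all of I,
-- since φ(S) is the least closed superset of S.  Hence if I meets X ∖ B, so
-- does S: transversals of H are inherited by generating sets.  If x ∈ φ(T ∖ {x})
-- then T ∖ {x} generates T, so it is again a transversal, contradicting the
-- minimality of T.
module Submission where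

open import Defs
open import Data.Nat using (ℕ)
open import Data.Fin using (_≟_)
open import Data.Fin.Subset
open import Data.Fin.Subset.Properties
  using (nonempty?; x∈p∩q⁺; x∈p∩q⁻; x∉p⇒x∈∁p; x∈∁p⇒x∉p; x∈p∧x≢y⇒x∈p-y; x∈p⇒p-x⊂p; p─q⊆p; _∈?_)
open import Data.List using (List)
import Data.List.Membership.Propositional as List
open import Data.List.Membership.Propositional.Properties using (∈-map⁻)
open import Data.Product using (_×_; _,_)
open import Relation.Nullary using (yes; no; contradiction)
open import Relation.Binary.PropositionalEquality using (refl)

private
  variable
    n : ℕ
    Σ : Base n
    B I S : Subset n

∈⇒∈φ : ∀ {x} → x ∈ S → x ∈φ (Σ , S)
∈⇒∈φ x∈S _ _ S⊆D = S⊆D x∈S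

⊆φ⇒⊆-closed : Closed Σ B → S ⊆ B → I ⊆φ (Σ , S) → I ⊆ B
⊆φ⇒⊆-closed closedB S⊆B I⊆φS x∈I = I⊆φS x∈I _ closedB S⊆B

Empty-∩∁⇒⊆ : Empty (S ∩ ∁ B) → S ⊆ B
Empty-∩∁⇒⊆ {B = B} S∩∁B≡∅ {x} x∈S with x ∈? B
... | yes x∈B = x∈B
... | no  x∉B = contradiction (x , x∈p∩q⁺ (x∈S , x∉p⇒x∈∁p x∉B)) S∩∁B≡∅

⊆φ-meets-∁closed : Closed Σ B → I ⊆φ (Σ , S) → Nonempty (I ∩ ∁ B) → Nonempty (S ∩ ∁ B)
⊆φ-meets-∁closed {B = B} {I = I} {S = S} closedB I⊆φS (x , x∈I∩∁B)
  with x∈p∩q⁻ I (∁ B) x∈I∩∁B | nonempty? (S ∩ ∁ B)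
... | _   , _    | yes S∩∁B≢∅ = S∩∁B≢∅
... | x∈I , x∈∁B | no  S∩∁B≡∅ =
  contradiction (⊆φ⇒⊆-closed closedB (Empty-∩∁⇒⊆ S∩∁B≡∅) I⊆φS x∈I) (x∈∁p⇒x∉p x∈∁B)

ClosedFamily : Base n → List (Subset n) → Set
ClosedFamily Σ 𝓑 = ∀ {B} → B List.∈ 𝓑 → Closed Σ B

⊆φ-transversal : ∀ {𝓑} → ClosedFamily Σ 𝓑 → I ⊆φ (Σ , S) →
                 IsTransversal (complements 𝓑) I → IsTransversal (complements 𝓑) S
⊆φ-transversal closed I⊆φS I-transversal E∈H with ∈-map⁻ ∁ E∈H
... | _ , B∈𝓑 , refl = ⊆φ-meets-∁closed (closed B∈𝓑) I⊆φS (I-transversal E∈H)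

dependent⇒⊆φ-remove : ∀ {T x} → x ∈φ (Σ , T - x) → T ⊆φ (Σ , T - x)
dependent⇒⊆φ-remove {x = x} x∈φT-x {y} y∈T with y ≟ x
... | yes refl = x∈φT-x
... | no  y≢x  = ∈⇒∈φ (x∈p∧x≢y⇒x∈p-y y∈T y≢x)

minimalTransversal⇒independent : ∀ {𝓑 T} → ClosedFamily Σ 𝓑 →
                                 IsMinimalTransversal (complements 𝓑) T → IsIndependent Σ T
minimalTransversal⇒independent {T = T} closed (T-transversal , T-minimal) {x} x∈T x∈φT-x
  with x∈p⇒p-x⊂p x∈T
... | _ , y , y∈T , y∉T-x =
  y∉T-x (T-minimal (T - x) (p─q⊆p T ⁅ x ⁆)
          (⊆φ-transversal closed (dependent⇒⊆φ-remove x∈φT-x) T-transversal) y∈T)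

lemma2 : ∀ (n : ℕ) (Σ : Base n) (𝓑 : List (Subset n)) → IsAntichain Σ 𝓑 → ((T : Subset n) → IsTransversal (complements 𝓑) T → (T* : Subset n) → IsMinimalGeneratingSet Σ T* T → IsTransversal (complements 𝓑) T*) × ((T : Subset n) → IsMinimalTransversal (complements 𝓑) T → IsIndependent Σ T)
lemma2 n Σ 𝓑 (closed , _) =
  (λ T T-transversal T* (_ , T⊆φT* , _) → ⊆φ-transversal closed T⊆φT* T-transversal) ,
  (λ T → minimalTransversal⇒independent closed)
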